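{- Let $a,b\in[n]$ with $0<a<b\le n$ and let $f=R^n_{a,b}$. Then $$\mathrm{size}_F^u(f)=\mathrm{size}_F^+(T^n_a)+\mathrm{size}_F^+(T^n_{n-(b-1)}).$$
   Context: Threshold function: $T^n_k(x)=1$ iff $x_1+\dots+x_n\ge k$. Range function: $R^n_{a,b}(x)=1$ iff $a\le x_1+\dots+x_n<b$. $\mathrm{size}_F^u(f)$: minimum number of leaves of a De Morgan formula (gates $\wedge,\vee$ fan-in 2, $\neg$) which, evaluated in Kleene three-valued logic ($\neg u=u$; $\vee$ is $1$ if some argument is $1$, $0$ if both are $0$, else $u$; $\wedge$ is $0$ if some argument is $0$, $1$ if both $1$, else $u$), outputs on every $x\in\{0,u,1\}^n$ the value $b\in\{0,1\}$ if $f(y)=b$ for all Boolean $y$ agreeing with $x$ on its non-$u$ coordinates, and $u$ otherwise. $\mathrm{size}_F^+(g)$ for monotone $g$: minimum number of leaves of a $\neg$-free formula computing $g$. -}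

module Defs where

open import Data.Nat using (ℕ; zero; suc; _+_; _≤_; _<_; _≤?_; _<?_)
open import Data.Fin using (Fin)
open import Data.Bool using (Bool; true; false; _∧_)
open import Data.Product using (Σ; _×_)
open import Data.Sum using (_⊎_)
open import Relation.Nullary using (¬_)
open import Relation.Nullary.Decidable using (⌊_⌋)
open import Relation.Binary.PropositionalEquality using (_≡_)

BoolFun : ℕ → Set
BoolFun n = (Fin n → Bool) → Bool

count : ∀ {n} → (Fin n → Bool) → ℕ
count {zero}  x = 0
count {suc n} x = (if0 (x Fin.zero)) + count {n} (λ i → x (Fin.suc i))
  where
  if0 : Bool → ℕ
  if0 true  = 1
  if0 false = 0

Thr : (n k : ℕ) → BoolFun n
Thr n k x = ⌊ k ≤? count x ⌋

Rng : (n a b : ℕ) → BoolFun n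
Rng n a b x = ⌊ a ≤? count x ⌋ ∧ ⌊ count x <? b ⌋

data K3 : Set where
  k0 ku k1 : K3

embed : Bool → K3
embed false = k0
embed true  = k1

notK : K3 → K3
notK k0 = k1
notK ku = ku
notK k1 = k0

orK : K3 → K3 → K3
orK k1 _  = k1
orK _  k1 = k1
orK k0 k0 = k0
orK _  _  = ku

andK : K3 → K3 → K3
andK k0 _  = k0
andK _  k0 = k0
andK k1 k1 = k1
andK _  _  = ku

data Formula (n : ℕ) : Set where
  var  : Fin n → Formula n
  ¬ᶠ   : Formula n → Formula n
  _∧ᶠ_ : Formula n → Formula n → Formula n
  _∨ᶠ_ : Formula n → Formula n → Formula n

leaves : ∀ {n} → Formula n → ℕ
leaves (var _)  = 1
leaves (¬ᶠ F)   = leaves F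
leaves (F ∧ᶠ G) = leaves F + leaves G
leaves (F ∨ᶠ G) = leaves F + leaves G

evalK : ∀ {n} → Formula n → (Fin n → K3) → K3
evalK (var i)  x = x i
evalK (¬ᶠ F)   x = notK (evalK F x)
evalK (F ∧ᶠ G) x = andK (evalK F x) (evalK G x)
evalK (F ∨ᶠ G) x = orK (evalK F x) (evalK G x)

Resolves : ∀ {n} → (Fin n → K3) → (Fin n → Bool) → Set
Resolves x y = ∀ i → x i ≡ ku ⊎ x i ≡ embed (y i)

ConstOn : ∀ {n} → BoolFun n → (Fin n → K3) → Bool → Set
ConstOn f x b = ∀ y → Resolves x y → f y ≡ b

HazardFree : ∀ {n} → Formula n → BoolFun n → Set
HazardFree F f = ∀ x →
  ((b : Bool) → ConstOn f x b → evalK F x ≡ embed b) ×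
  (((b : Bool) → ¬ ConstOn f x b) → evalK F x ≡ ku)

IsSizeU : ∀ {n} → BoolFun n → ℕ → Set
IsSizeU {n} f s =
  Σ (Formula n) (λ F → HazardFree F f × leaves F ≡ s) ×
  (∀ (F : Formula n) → HazardFree F f → s ≤ leaves F)

data MFormula (n : ℕ) : Set where
  var  : Fin n → MFormula n
  _∧ᵐ_ : MFormula n → MFormula n → MFormula n
  _∨ᵐ_ : MFormula n → MFormula n → MFormula n

mleaves : ∀ {n} → MFormula n → ℕ
mleaves (var _)  = 1
mleaves (F ∧ᵐ G) = mleaves F + mleaves G
mleaves (F ∨ᵐ G) = mleaves F + mleaves G

evalM : ∀ {n} → MFormula n → (Fin n → Bool) → Bool
evalM (var i)  y = y i
evalM (F ∧ᵐ G) y = evalM F y ∧ evalM G y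
evalM (F ∨ᵐ G) y = evalM F y Data.Bool.∨ evalM G y

MComputes : ∀ {n} → MFormula n → BoolFun n → Set
MComputes F g = ∀ y → evalM F y ≡ g y

IsSizeMono : ∀ {n} → BoolFun n → ℕ → Set
IsSizeMono {n} g s =
  Σ (MFormula n) (λ F → MComputes F g × mleaves F ≡ s) ×
  (∀ (F : MFormula n) → MComputes F g → s ≤ mleaves F)

-- Write k and K for the number of ones in the least and in the greatest resolution of
-- x ∈ {0,u,1}ⁿ.  The resolutions of x realise exactly the counts in [k, K], so the
-- hazard-free extension of R_{a,b} is 1 at x iff [k, K] ⊆ [a, b), 0 iff the two intervals
-- are disjoint, and u otherwise; equivalently its lower bit is [a ≤ k ∧ K < b] and its
-- upper bit is [a ≤ K ∧ k < b].
--
-- Upper bound: a monotone formula evaluates in Kleene logic to the interval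
-- [M(lower x), M(upper x)], so for monotone M₁ = T_a and M₂ = T_{n-b+1} the formula
-- M₁(x) ∧ M₂(¬x) has exactly these two bits.
--
-- Lower bound: push the negations of a hazard-free F to its leaves.  Feed it y with its
-- ones replaced by u and its zeros kept: the upper bit of F is then T_a(y), while every
-- negative literal has upper bit 1; setting the negative literals to 1 therefore leaves a
-- monotone formula for T_a on the positive leaves.  With the zeros of y turned into ones
-- instead, the negative leaves give in the same way a monotone formula for T_{n-b+1}.
-- No leaf is used twice, so the two minimal sizes add up to at most the size of F.
module Submission where

open import Data.Bool using (Bool; true; false; _∧_; _∨_; not; _xor_; if_then_else_; f≤t; b≤b)
  renaming (_≤_ to _≤ᴮ_)
open import Data.Bool.Properties
  using (≤-minimum; ≤-maximum; ∧-zeroʳ; ∧-identityʳ; ∨-zeroʳ; ∨-identityʳ; not-involutive)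
  renaming (_≟_ to _≟ᴮ_)
open import Data.Empty using (⊥-elim)
open import Data.Fin using (Fin; zero; suc)
open import Data.Fin.Subset.Properties using (anySubset?)
open import Data.List using (List; []; map; _++_; cartesianProductWith; allFin)
open import Data.List.Membership.Propositional using (_∈_; lose)
open import Data.List.Membership.Propositional.Properties
  using (∈-map⁺; ∈-++⁺ˡ; ∈-++⁺ʳ; ∈-cartesianProductWith⁺; ∈-allFin)
open import Data.List.Relation.Unary.Any using (any?; satisfied)
open import Data.Nat using (ℕ; zero; suc; _+_; _∸_; _≤_; _<_; _≤?_; _<?_; _≟_; z≤n; s≤s; s≤s⁻¹)
open import Data.Nat.Properties
open import Algebra.Properties.CommutativeSemigroup +-commutativeSemigroup using (interchange)
open import Data.Product using (Σ; _×_; _,_; proj₁; proj₂)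
open import Data.Sum using (_⊎_; inj₁; inj₂; [_,_])
open import Data.Vec using (lookup; tabulate)
open import Data.Vec.Properties using (lookup∘tabulate)
open import Data.Vec.Functional using (_∷_; tail)
open import Function using (_∘_; id; flip; case_of_)
open import Function.Bundles using (_⇔_; mk⇔)
open import Relation.Binary.PropositionalEquality hiding ([_])
open import Relation.Nullary using (¬_; Dec; yes; no; ¬?)
open import Relation.Nullary.Decidable
  using (⌊_⌋; does-⇔; isYes≗does; _×-dec_; map′; decidable-stable)
import Relation.Unary as U
open import Defs

isYes-true : ∀ {A : Set} (a? : Dec A) → A → ⌊ a? ⌋ ≡ true
isYes-true (yes _) _ = refl
isYes-true (no ¬a) a = ⊥-elim (¬a a)

isYes-false : ∀ {A : Set} (a? : Dec A) → ¬ A → ⌊ a? ⌋ ≡ false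
isYes-false (yes a) ¬a = ⊥-elim (¬a a)
isYes-false (no _)  _  = refl

isYes-⇔ : ∀ {A B : Set} → A ⇔ B → (a? : Dec A) (b? : Dec B) → ⌊ a? ⌋ ≡ ⌊ b? ⌋
isYes-⇔ A⇔B a? b? = trans (isYes≗does a?) (trans (does-⇔ A⇔B a? b?) (sym (isYes≗does b?)))

count-cong : ∀ {n} {y z : Fin n → Bool} → y ≗ z → count y ≡ count z
count-cong {zero}  y≗z = refl
count-cong {suc n} {y} {z} y≗z with y zero | z zero | y≗z zero
... | false | .false | refl = count-cong (y≗z ∘ suc)
... | true  | .true  | refl = cong suc (count-cong (y≗z ∘ suc))

count-mono : ∀ {n} {y z : Fin n → Bool} → (∀ i → y i ≤ᴮ z i) → count y ≤ count z
count-mono {zero}  y≤z = z≤n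
count-mono {suc n} {y} {z} y≤z with y zero | z zero | y≤z zero
... | false | true  | f≤t = m≤n⇒m≤1+n (count-mono (y≤z ∘ suc))
... | false | false | b≤b = count-mono (y≤z ∘ suc)
... | true  | true  | b≤b = s≤s (count-mono (y≤z ∘ suc))

count-complement : ∀ {n} {y z : Fin n → Bool} → (∀ i → y i ≡ not (z i)) → count y + count z ≡ n
count-complement {zero}  y≗¬z = refl
count-complement {suc n} {y} {z} y≗¬z with y zero | z zero | y≗¬z zero
... | true  | false | refl = cong suc (count-complement (y≗¬z ∘ suc))
... | false | true  | refl = trans (+-suc _ _) (cong suc (count-complement (y≗¬z ∘ suc)))

count-false : ∀ {n} {y : Fin n → Bool} → (∀ i → y i ≡ false) → count y ≡ 0
count-false {zero}  y≗false = refl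
count-false {suc n} y≗false rewrite y≗false zero = count-false (y≗false ∘ suc)

count-true : ∀ {n} {y : Fin n → Bool} → (∀ i → y i ≡ true) → count y ≡ n
count-true {zero}  y≗true = refl
count-true {suc n} y≗true rewrite y≗true zero = cong suc (count-true (y≗true ∘ suc))

complement-threshold : ∀ {c c̄ n} t → c + c̄ ≡ n → ⌊ n ∸ t ≤? c ⌋ ≡ ⌊ c̄ <? suc t ⌋
complement-threshold {c} {c̄} t refl = isYes-⇔ (mk⇔ to from) (c + c̄ ∸ t ≤? c) (c̄ <? suc t)
  where
  open ≤-Reasoning
  to : c + c̄ ∸ t ≤ c → c̄ < suc t
  to n∸t≤c = s≤s (+-cancelˡ-≤ c c̄ t (begin
    c + c̄             ≤⟨ m≤n+m∸n (c + c̄) t ⟩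
    t + (c + c̄ ∸ t)   ≤⟨ +-monoʳ-≤ t n∸t≤c ⟩
    t + c             ≡⟨ +-comm t c ⟩
    c + t             ∎))
  from : c̄ < suc t → c + c̄ ∸ t ≤ c
  from (s≤s c̄≤t) = begin
    c + c̄ ∸ t   ≤⟨ ∸-monoʳ-≤ (c + c̄) c̄≤t ⟩
    c + c̄ ∸ c̄   ≡⟨ m+n∸n≡m c c̄ ⟩
    c           ∎

lower upper : K3 → Bool
lower k1 = true
lower _  = false
upper k0 = false
upper _  = true

lower-upper-injective : ∀ {u v} → lower u ≡ lower v → upper u ≡ upper v → u ≡ v
lower-upper-injective {k0} {k0} _ _  = refl
lower-upper-injective {ku} {ku} _ _  = refl
lower-upper-injective {k1} {k1} _ _  = refl
lower-upper-injective {k0} {ku} _ ()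
lower-upper-injective {ku} {k0} _ ()
lower-upper-injective {k0} {k1} () _
lower-upper-injective {k1} {k0} () _
lower-upper-injective {ku} {k1} () _
lower-upper-injective {k1} {ku} () _

lower-andK : ∀ u v → lower (andK u v) ≡ lower u ∧ lower v
lower-andK k0 v  = refl
lower-andK ku k0 = refl
lower-andK ku ku = refl
lower-andK ku k1 = refl
lower-andK k1 k0 = refl
lower-andK k1 ku = refl
lower-andK k1 k1 = refl

upper-andK : ∀ u v → upper (andK u v) ≡ upper u ∧ upper v
upper-andK k0 v  = refl
upper-andK ku k0 = refl
upper-andK ku ku = refl
upper-andK ku k1 = refl
upper-andK k1 k0 = refl
upper-andK k1 ku = refl
upper-andK k1 k1 = refl

lower-orK : ∀ u v → lower (orK u v) ≡ lower u ∨ lower v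
lower-orK k1 v  = refl
lower-orK ku k0 = refl
lower-orK ku ku = refl
lower-orK ku k1 = refl
lower-orK k0 k0 = refl
lower-orK k0 ku = refl
lower-orK k0 k1 = refl

upper-orK : ∀ u v → upper (orK u v) ≡ upper u ∨ upper v
upper-orK k1 v  = refl
upper-orK ku k0 = refl
upper-orK ku ku = refl
upper-orK ku k1 = refl
upper-orK k0 k0 = refl
upper-orK k0 ku = refl
upper-orK k0 k1 = refl

lower-notK : ∀ v → lower (notK v) ≡ not (upper v)
lower-notK k0 = refl
lower-notK ku = refl
lower-notK k1 = refl

upper-notK : ∀ v → upper (notK v) ≡ not (lower v)
upper-notK k0 = refl
upper-notK ku = refl
upper-notK k1 = refl

notK-andK : ∀ u v → notK (andK u v) ≡ orK (notK u) (notK v)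
notK-andK k0 v  = refl
notK-andK ku k0 = refl
notK-andK ku ku = refl
notK-andK ku k1 = refl
notK-andK k1 k0 = refl
notK-andK k1 ku = refl
notK-andK k1 k1 = refl

notK-orK : ∀ u v → notK (orK u v) ≡ andK (notK u) (notK v)
notK-orK k1 v  = refl
notK-orK ku k0 = refl
notK-orK ku ku = refl
notK-orK ku k1 = refl
notK-orK k0 k0 = refl
notK-orK k0 ku = refl
notK-orK k0 k1 = refl

resolves⇒bounded : ∀ {v b} → v ≡ ku ⊎ v ≡ embed b → lower v ≤ᴮ b × b ≤ᴮ upper v
resolves⇒bounded             (inj₁ refl) = ≤-minimum _ , ≤-maximum _
resolves⇒bounded {b = false} (inj₂ refl) = b≤b , b≤b
resolves⇒bounded {b = true}  (inj₂ refl) = b≤b , b≤b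

lower-resolves : ∀ v → v ≡ ku ⊎ v ≡ embed (lower v)
lower-resolves k0 = inj₂ refl
lower-resolves ku = inj₁ refl
lower-resolves k1 = inj₂ refl

upper-resolves : ∀ v → v ≡ ku ⊎ v ≡ embed (upper v)
upper-resolves k0 = inj₂ refl
upper-resolves ku = inj₁ refl
upper-resolves k1 = inj₂ refl

lowerCount upperCount : ∀ {n} → (Fin n → K3) → ℕ
lowerCount x = count (lower ∘ x)
upperCount x = count (upper ∘ x)

resolution-count-bounds : ∀ {n} {x : Fin n → K3} {z} → Resolves x z →
  lowerCount x ≤ count z × count z ≤ upperCount x
resolution-count-bounds r =
  count-mono (proj₁ ∘ resolves⇒bounded ∘ r) , count-mono (proj₂ ∘ resolves⇒bounded ∘ r)

lowerCount≤upperCount : ∀ {n} (x : Fin n → K3) → lowerCount x ≤ upperCount x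
lowerCount≤upperCount x = proj₁ (resolution-count-bounds (upper-resolves ∘ x))

∷-resolves : ∀ {n} {x : Fin (suc n) → K3} {b z} →
  x zero ≡ ku ⊎ x zero ≡ embed b → Resolves (tail x) z → Resolves x (b ∷ z)
∷-resolves r₀ r zero    = r₀
∷-resolves r₀ r (suc i) = r i

resolution-with-count : ∀ {n} (x : Fin n → K3) {c} → lowerCount x ≤ c → c ≤ upperCount x →
  Σ (Fin n → Bool) λ z → Resolves x z × count z ≡ c
resolution-with-count {zero} x z≤n z≤n = (λ ()) , (λ ()) , refl
resolution-with-count {suc n} x k≤c c≤K with x zero in x₀≡
resolution-with-count {suc n} x k≤c c≤K | k0 =
  let z , r , e = resolution-with-count (tail x) k≤c c≤K
  in false ∷ z , ∷-resolves (inj₂ x₀≡) r , e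
resolution-with-count {suc n} x (s≤s k≤c) (s≤s c≤K) | k1 =
  let z , r , e = resolution-with-count (tail x) k≤c c≤K
  in true ∷ z , ∷-resolves (inj₂ x₀≡) r , cong suc e
resolution-with-count {suc n} x {c} k≤c c≤K | ku with c ≤? upperCount (tail x)
... | yes c≤K′ =
  let z , r , e = resolution-with-count (tail x) k≤c c≤K′
  in false ∷ z , ∷-resolves (inj₁ x₀≡) r , e
resolution-with-count {suc n} x {zero} k≤c c≤K | ku | no c≰K′ = ⊥-elim (c≰K′ z≤n)
resolution-with-count {suc n} x {suc c} k≤c (s≤s c≤K) | ku | no c≰K′ =
  let z , r , e = resolution-with-count (tail x)
                    (≤-pred (≤-<-trans (lowerCount≤upperCount (tail x)) (≰⇒> c≰K′))) c≤K
  in true ∷ z , ∷-resolves (inj₁ x₀≡) r , cong suc e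

HazardFreeAt : ∀ {n} → Formula n → BoolFun n → (Fin n → K3) → Set
HazardFreeAt F f x =
  ((b : Bool) → ConstOn f x b → evalK F x ≡ embed b) ×
  (((b : Bool) → ¬ ConstOn f x b) → evalK F x ≡ ku)

Attains : ∀ {n} → BoolFun n → (Fin n → K3) → Bool → Set
Attains {n} f x b = Σ (Fin n → Bool) λ z → Resolves x z × f z ≡ b

data HazardFreeValue {n} (f : BoolFun n) (x : Fin n → K3) : K3 → Set where
  constant : ∀ {b} → ConstOn f x b → HazardFreeValue f x (embed b)
  unstable : Attains f x false → Attains f x true → HazardFreeValue f x ku

module _ {n} {f : BoolFun n} {x : Fin n → K3} where

  attains-constOn : ∀ {b b′} → Attains f x b → ConstOn f x b′ → b ≡ b′
  attains-constOn (z , r , fz≡b) c = trans (sym fz≡b) (c z r)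

  constOn⇒attains : ∀ {b} → ConstOn f x b → Attains f x b
  constOn⇒attains c = lower ∘ x , lower-resolves ∘ x , c (lower ∘ x) (lower-resolves ∘ x)

  unstable⇒¬constOn : ∀ {b} → Attains f x false → Attains f x true → ¬ ConstOn f x b
  unstable⇒¬constOn a₀ a₁ c with trans (attains-constOn a₀ c) (sym (attains-constOn a₁ c))
  ... | ()

  hazardFreeAt⇒value : ∀ {F v} → HazardFreeValue f x v → HazardFreeAt F f x → evalK F x ≡ v
  hazardFreeAt⇒value (constant c)     hf = proj₁ hf _ c
  hazardFreeAt⇒value (unstable a₀ a₁) hf = proj₂ hf (λ _ → unstable⇒¬constOn a₀ a₁)

  value⇒hazardFreeAt : ∀ {F v} → HazardFreeValue f x v → evalK F x ≡ v → HazardFreeAt F f x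
  value⇒hazardFreeAt (constant {b} c) Fx≡v =
    (λ b′ c′ → trans Fx≡v (cong embed (attains-constOn (constOn⇒attains c) c′))) ,
    (λ ¬c → ⊥-elim (¬c b c))
  value⇒hazardFreeAt (unstable a₀ a₁) Fx≡v =
    (λ _ c → ⊥-elim (unstable⇒¬constOn a₀ a₁ c)) , (λ _ → Fx≡v)

module _ {n a b : ℕ} where

  Rng-true : ∀ {z : Fin n → Bool} → a ≤ count z → count z < b → Rng n a b z ≡ true
  Rng-true {z} a≤c c<b = cong₂ _∧_ (isYes-true (a ≤? count z) a≤c) (isYes-true (count z <? b) c<b)

  Rng-false : ∀ {z : Fin n → Bool} → count z < a ⊎ b ≤ count z → Rng n a b z ≡ false
  Rng-false {z} (inj₁ c<a) = cong (_∧ _) (isYes-false (a ≤? count z) (<⇒≱ c<a))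
  Rng-false {z} (inj₂ b≤c) = trans (cong (_ ∧_) (isYes-false (count z <? b) (≤⇒≯ b≤c))) (∧-zeroʳ _)

  module _ {x : Fin n → K3} where

    Rng-constOn-true : a ≤ lowerCount x → upperCount x < b → ConstOn (Rng n a b) x true
    Rng-constOn-true a≤k K<b z r =
      let k≤c , c≤K = resolution-count-bounds r in Rng-true (≤-trans a≤k k≤c) (≤-<-trans c≤K K<b)

    Rng-constOn-false : upperCount x < a ⊎ b ≤ lowerCount x → ConstOn (Rng n a b) x false
    Rng-constOn-false (inj₁ K<a) z r =
      Rng-false (inj₁ (≤-<-trans (proj₂ (resolution-count-bounds r)) K<a))
    Rng-constOn-false (inj₂ b≤k) z r =
      Rng-false (inj₂ (≤-trans b≤k (proj₁ (resolution-count-bounds r))))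

    Rng-attains-true : a < b → a ≤ upperCount x → lowerCount x < b → Attains (Rng n a b) x true
    Rng-attains-true a<b a≤K k<b =
      let z , r , c≡a⊔k = resolution-with-count x (m≤n⊔m a _) (⊔-lub a≤K (lowerCount≤upperCount x))
      in z , r , Rng-true (≤-trans (m≤m⊔n a _) (≤-reflexive (sym c≡a⊔k)))
                          (≤-<-trans (≤-reflexive c≡a⊔k) (⊔-pres-<m a<b k<b))

    Rng-attains-false : lowerCount x < a ⊎ b ≤ upperCount x → Attains (Rng n a b) x false
    Rng-attains-false (inj₁ k<a) = lower ∘ x , lower-resolves ∘ x , Rng-false (inj₁ k<a)
    Rng-attains-false (inj₂ b≤K) = upper ∘ x , upper-resolves ∘ x , Rng-false (inj₂ b≤K)

lowerRng upperRng : ∀ {n} → ℕ → ℕ → (Fin n → K3) → Bool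
lowerRng a b x = ⌊ a ≤? lowerCount x ⌋ ∧ ⌊ upperCount x <? b ⌋
upperRng a b x = ⌊ a ≤? upperCount x ⌋ ∧ ⌊ lowerCount x <? b ⌋

Rng-hazardFreeValue : ∀ {n a b} → a < b → (x : Fin n → K3) →
  Σ K3 λ v → HazardFreeValue (Rng n a b) x v × lower v ≡ lowerRng a b x × upper v ≡ upperRng a b x
Rng-hazardFreeValue {a = a} {b} a<b x with a ≤? upperCount x | lowerCount x <? b
... | no a≰K | _ =
  k0 , constant (Rng-constOn-false (inj₁ (≰⇒> a≰K))) ,
  sym (cong (_∧ _) (isYes-false (a ≤? lowerCount x) (a≰K ∘ flip ≤-trans (lowerCount≤upperCount x)))) ,
  refl
... | yes _ | no k≮b =
  k0 , constant (Rng-constOn-false (inj₂ (≮⇒≥ k≮b))) ,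
  sym (trans (cong (_ ∧_) (isYes-false (upperCount x <? b) (k≮b ∘ ≤-<-trans (lowerCount≤upperCount x))))
             (∧-zeroʳ _)) ,
  refl
... | yes a≤K | yes k<b with a ≤? lowerCount x | upperCount x <? b
...   | yes a≤k | yes K<b = k1 , constant (Rng-constOn-true a≤k K<b) , refl , refl
...   | no a≰k  | _       =
  ku , unstable (Rng-attains-false (inj₁ (≰⇒> a≰k))) (Rng-attains-true a<b a≤K k<b) , refl , refl
...   | yes _   | no K≮b  =
  ku , unstable (Rng-attains-false (inj₂ (≮⇒≥ K≮b))) (Rng-attains-true a<b a≤K k<b) , refl , refl

hazardFree-Rng⇒upper : ∀ {n a b} {F : Formula n} → a < b → HazardFree F (Rng n a b) →
  ∀ x → upper (evalK F x) ≡ upperRng a b x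
hazardFree-Rng⇒upper {F = F} a<b hf x =
  let v , value , _ , upper-v = Rng-hazardFreeValue a<b x
  in trans (cong upper (hazardFreeAt⇒value {F = F} value (hf x))) upper-v

bounds⇒hazardFree-Rng : ∀ {n a b} {F : Formula n} → a < b →
  (∀ x → lower (evalK F x) ≡ lowerRng a b x) → (∀ x → upper (evalK F x) ≡ upperRng a b x) →
  HazardFree F (Rng n a b)
bounds⇒hazardFree-Rng {F = F} a<b lower-F upper-F x =
  let v , value , lower-v , upper-v = Rng-hazardFreeValue a<b x
  in value⇒hazardFreeAt {F = F} value
       (lower-upper-injective (trans (lower-F x) (sym lower-v)) (trans (upper-F x) (sym upper-v)))

data MFormulaᶜ (n : ℕ) : Set where
  const : Bool → MFormulaᶜ n
  ⌜_⌝   : MFormula n → MFormulaᶜ n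

module _ {n : ℕ} where

  evalᶜ : MFormulaᶜ n → (Fin n → Bool) → Bool
  evalᶜ (const b) y = b
  evalᶜ ⌜ M ⌝     y = evalM M y

  leavesᶜ : MFormulaᶜ n → ℕ
  leavesᶜ (const _) = 0
  leavesᶜ ⌜ M ⌝     = mleaves M

  infixr 6 _∧ᶜ_
  infixr 5 _∨ᶜ_

  _∧ᶜ_ _∨ᶜ_ : MFormulaᶜ n → MFormulaᶜ n → MFormulaᶜ n
  const false ∧ᶜ _           = const false
  const true  ∧ᶜ B           = B
  ⌜ M ⌝       ∧ᶜ const false = const false
  ⌜ M ⌝       ∧ᶜ const true  = ⌜ M ⌝
  ⌜ M ⌝       ∧ᶜ ⌜ N ⌝       = ⌜ M ∧ᵐ N ⌝
  const false ∨ᶜ B           = B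
  const true  ∨ᶜ _           = const true
  ⌜ M ⌝       ∨ᶜ const false = ⌜ M ⌝
  ⌜ M ⌝       ∨ᶜ const true  = const true
  ⌜ M ⌝       ∨ᶜ ⌜ N ⌝       = ⌜ M ∨ᵐ N ⌝

  evalᶜ-∧ᶜ : ∀ A B y → evalᶜ (A ∧ᶜ B) y ≡ evalᶜ A y ∧ evalᶜ B y
  evalᶜ-∧ᶜ (const false) B             y = refl
  evalᶜ-∧ᶜ (const true)  B             y = refl
  evalᶜ-∧ᶜ ⌜ M ⌝         (const false) y = sym (∧-zeroʳ _)
  evalᶜ-∧ᶜ ⌜ M ⌝         (const true)  y = sym (∧-identityʳ _)
  evalᶜ-∧ᶜ ⌜ M ⌝         ⌜ N ⌝         y = refl

  evalᶜ-∨ᶜ : ∀ A B y → evalᶜ (A ∨ᶜ B) y ≡ evalᶜ A y ∨ evalᶜ B y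
  evalᶜ-∨ᶜ (const false) B             y = refl
  evalᶜ-∨ᶜ (const true)  B             y = refl
  evalᶜ-∨ᶜ ⌜ M ⌝         (const false) y = sym (∨-identityʳ _)
  evalᶜ-∨ᶜ ⌜ M ⌝         (const true)  y = sym (∨-zeroʳ _)
  evalᶜ-∨ᶜ ⌜ M ⌝         ⌜ N ⌝         y = refl

  leavesᶜ-∧ᶜ : ∀ A B → leavesᶜ (A ∧ᶜ B) ≤ leavesᶜ A + leavesᶜ B
  leavesᶜ-∧ᶜ (const false) B             = z≤n
  leavesᶜ-∧ᶜ (const true)  B             = ≤-refl
  leavesᶜ-∧ᶜ ⌜ M ⌝         (const false) = z≤n
  leavesᶜ-∧ᶜ ⌜ M ⌝         (const true)  = m≤m+n _ 0
  leavesᶜ-∧ᶜ ⌜ M ⌝         ⌜ N ⌝         = ≤-refl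

  leavesᶜ-∨ᶜ : ∀ A B → leavesᶜ (A ∨ᶜ B) ≤ leavesᶜ A + leavesᶜ B
  leavesᶜ-∨ᶜ (const false) B             = ≤-refl
  leavesᶜ-∨ᶜ (const true)  B             = z≤n
  leavesᶜ-∨ᶜ ⌜ M ⌝         (const false) = m≤m+n _ 0
  leavesᶜ-∨ᶜ ⌜ M ⌝         (const true)  = z≤n
  leavesᶜ-∨ᶜ ⌜ M ⌝         ⌜ N ⌝         = ≤-refl

  NonConstant : BoolFun n → Set
  NonConstant g = Σ (Fin n → Bool) λ y₀ → Σ (Fin n → Bool) λ y₁ → g y₀ ≢ g y₁

  monotoneFormula : ∀ {g : BoolFun n} (C : MFormulaᶜ n) → (∀ y → evalᶜ C y ≡ g y) → NonConstant g →
    Σ (MFormula n) λ M → MComputes M g × mleaves M ≡ leavesᶜ C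
  monotoneFormula (const b) C≗g (y₀ , y₁ , g₀≢g₁) = ⊥-elim (g₀≢g₁ (trans (sym (C≗g y₀)) (C≗g y₁)))
  monotoneFormula ⌜ M ⌝     C≗g _                  = M , C≗g , refl

  size≤leavesᶜ : ∀ {g : BoolFun n} {s} → IsSizeMono g s → (C : MFormulaᶜ n) →
    (∀ y → evalᶜ C y ≡ g y) → NonConstant g → s ≤ leavesᶜ C
  size≤leavesᶜ (_ , minimal) C C≗g g-nonconstant =
    let M , M-g , M≡C = monotoneFormula C C≗g g-nonconstant in ≤-trans (minimal M M-g) (≤-reflexive M≡C)

Thr-step : ∀ {n} t (y : Fin (suc n) → Bool) →
  (y zero ∧ Thr n t (tail y)) ∨ Thr n (suc t) (tail y) ≡ Thr (suc n) (suc t) y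
Thr-step {n} t y with y zero
... | false = refl
... | true with t ≤? count (tail y)
...   | yes t≤c = sym (isYes-true (suc t ≤? suc (count (tail y))) (s≤s t≤c))
...   | no t≰c  = trans (isYes-false (suc t ≤? count (tail y)) (t≰c ∘ <⇒≤))
                        (sym (isYes-false (suc t ≤? suc (count (tail y))) (t≰c ∘ s≤s⁻¹)))

thresholdOver : ∀ {m} n → (Fin n → Fin m) → ℕ → MFormulaᶜ m
thresholdOver n       ρ zero    = const true
thresholdOver zero    ρ (suc t) = const false
thresholdOver (suc n) ρ (suc t) =
  ⌜ var (ρ zero) ⌝ ∧ᶜ thresholdOver n (ρ ∘ suc) t ∨ᶜ thresholdOver n (ρ ∘ suc) (suc t)

evalᶜ-thresholdOver : ∀ {m} n (ρ : Fin n → Fin m) t y → evalᶜ (thresholdOver n ρ t) y ≡ Thr n t (y ∘ ρ)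
evalᶜ-thresholdOver n       ρ zero    y = refl
evalᶜ-thresholdOver zero    ρ (suc t) y = refl
evalᶜ-thresholdOver (suc n) ρ (suc t) y = begin
  evalᶜ (⌜ var (ρ zero) ⌝ ∧ᶜ A ∨ᶜ B) y         ≡⟨ evalᶜ-∨ᶜ (⌜ var (ρ zero) ⌝ ∧ᶜ A) B y ⟩
  evalᶜ (⌜ var (ρ zero) ⌝ ∧ᶜ A) y ∨ evalᶜ B y  ≡⟨ cong (_∨ evalᶜ B y) (evalᶜ-∧ᶜ ⌜ var (ρ zero) ⌝ A y) ⟩
  (y (ρ zero) ∧ evalᶜ A y) ∨ evalᶜ B y         ≡⟨ cong₂ (λ u v → (y (ρ zero) ∧ u) ∨ v)
                                                    (evalᶜ-thresholdOver n (ρ ∘ suc) t y)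
                                                    (evalᶜ-thresholdOver n (ρ ∘ suc) (suc t) y) ⟩
  (y (ρ zero) ∧ Thr n t (y ∘ ρ ∘ suc)) ∨ Thr n (suc t) (y ∘ ρ ∘ suc)
                                               ≡⟨ Thr-step t (y ∘ ρ) ⟩
  Thr (suc n) (suc t) (y ∘ ρ)                  ∎
  where
  open ≡-Reasoning
  A B : MFormulaᶜ _
  A = thresholdOver n (ρ ∘ suc) t
  B = thresholdOver n (ρ ∘ suc) (suc t)

Thr-nonconstant : ∀ {n t} → 0 < t → t ≤ n → NonConstant (Thr n t)
Thr-nonconstant {n} {t} 0<t t≤n =
  (λ _ → false) , (λ _ → true) ,
  λ Thr₀≡Thr₁ → case trans (sym Thr₀≡false) (trans Thr₀≡Thr₁ Thr₁≡true) of λ ()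
  where
  Thr₀≡false : Thr n t (λ _ → false) ≡ false
  Thr₀≡false = isYes-false (t ≤? count {n} (λ _ → false))
                           (<⇒≱ (subst (_< t) (sym (count-false {n} (λ _ → refl))) 0<t))
  Thr₁≡true : Thr n t (λ _ → true) ≡ true
  Thr₁≡true = isYes-true (t ≤? count {n} (λ _ → true)) (subst (t ≤_) (sym (count-true {n} (λ _ → refl))) t≤n)

thresholdFormula : ∀ {n t} → 0 < t → t ≤ n → Σ (MFormula n) λ M → MComputes M (Thr n t)
thresholdFormula {n} {t} 0<t t≤n =
  let M , M-Thr , _ = monotoneFormula (thresholdOver n id t) (evalᶜ-thresholdOver n id t)
                                      (Thr-nonconstant 0<t t≤n)
  in M , M-Thr

module _ {P : ℕ → Set} (P? : U.Decidable P) where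

  minimal : ∀ {k} → P k → Σ ℕ λ s → P s × (∀ {m} → P m → s ≤ m)
  minimal {k} p = [ (λ none → ⊥-elim (none (n<1+n k) p)) , id ] (search (suc k))
    where
    search : ∀ k → (∀ {m} → m < k → ¬ P m) ⊎ (Σ ℕ λ s → P s × (∀ {m} → P m → s ≤ m))
    search zero = inj₁ (λ ())
    search (suc k) with search k
    ... | inj₂ found = inj₂ found
    ... | inj₁ none with P? k
    ...   | yes p = inj₂ (k , p , λ pm → ≮⇒≥ (λ m<k → none m<k pm))
    ...   | no ¬p = inj₁ (λ m<1+k → [ none , (λ { refl → ¬p }) ] (m<1+n⇒m<n∨m≡n m<1+k))

formulasUpTo : ∀ n → ℕ → List (MFormula n)
formulasUpTo n zero    = []
formulasUpTo n (suc k) =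
  map var (allFin n) ++ cartesianProductWith _∧ᵐ_ Fs Fs ++ cartesianProductWith _∨ᵐ_ Fs Fs
  where Fs = formulasUpTo n k

0<mleaves : ∀ {n} (M : MFormula n) → 0 < mleaves M
0<mleaves (var _)  = s≤s z≤n
0<mleaves (M ∧ᵐ N) = <-≤-trans (0<mleaves M) (m≤m+n _ _)
0<mleaves (M ∨ᵐ N) = <-≤-trans (0<mleaves M) (m≤m+n _ _)

mleaves-operands : ∀ {n k} (M N : MFormula n) → mleaves M + mleaves N ≤ suc k → mleaves M ≤ k × mleaves N ≤ k
mleaves-operands M N M+N≤1+k =
  s≤s⁻¹ (≤-trans (m<m+n _ (0<mleaves N)) M+N≤1+k) , s≤s⁻¹ (≤-trans (m<n+m _ (0<mleaves M)) M+N≤1+k)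

∈-formulasUpTo : ∀ {n k} (M : MFormula n) → mleaves M ≤ k → M ∈ formulasUpTo n k
∈-formulasUpTo {k = zero}  M       M≤0 = ⊥-elim (<⇒≱ (0<mleaves M) M≤0)
∈-formulasUpTo {k = suc k} (var i) _   = ∈-++⁺ˡ (∈-map⁺ var (∈-allFin i))
∈-formulasUpTo {n} {suc k} (M ∧ᵐ N) M+N≤1+k =
  let M≤k , N≤k = mleaves-operands M N M+N≤1+k
  in ∈-++⁺ʳ (map var (allFin n)) (∈-++⁺ˡ
       (∈-cartesianProductWith⁺ _∧ᵐ_ (∈-formulasUpTo M M≤k) (∈-formulasUpTo N N≤k)))
∈-formulasUpTo {n} {suc k} (M ∨ᵐ N) M+N≤1+k =
  let M≤k , N≤k = mleaves-operands M N M+N≤1+k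
  in ∈-++⁺ʳ (map var (allFin n)) (∈-++⁺ʳ (cartesianProductWith _∧ᵐ_ (formulasUpTo n k) (formulasUpTo n k))
       (∈-cartesianProductWith⁺ _∨ᵐ_ (∈-formulasUpTo M M≤k) (∈-formulasUpTo N N≤k)))

∃-formula? : ∀ {n} {P : MFormula n → Set} → U.Decidable P →
  ∀ s → Dec (Σ (MFormula n) λ M → P M × mleaves M ≡ s)
∃-formula? {n} P? s =
  map′ satisfied (λ (M , p , M≡s) → lose (∈-formulasUpTo M (≤-reflexive M≡s)) (p , M≡s))
       (any? (λ M → P? M ×-dec (mleaves M ≟ s)) (formulasUpTo n s))

minimalFormula : ∀ {n} {P : MFormula n → Set} → U.Decidable P → Σ (MFormula n) P →
  Σ ℕ λ s → Σ (MFormula n) (λ M → P M × mleaves M ≡ s) × (∀ M → P M → s ≤ mleaves M)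
minimalFormula P? (M , p) =
  let s , found , least = minimal (∃-formula? P?) (M , p , refl)
  in s , found , λ N q → least (N , q , refl)

all-assignments? : ∀ {n} {P : (Fin n → Bool) → Set} → (∀ {y z} → y ≗ z → P y → P z) →
  U.Decidable P → Dec (∀ y → P y)
all-assignments? resp P? with anySubset? (λ v → ¬? (P? (lookup v)))
... | yes (v , ¬p) = no (λ all → ¬p (all (lookup v)))
... | no ¬∃        =
  yes (λ y → resp (lookup∘tabulate y) (decidable-stable (P? _) (λ ¬p → ¬∃ (tabulate y , ¬p))))

Extensional : ∀ {n} → BoolFun n → Set
Extensional {n} g = ∀ {y z : Fin n → Bool} → y ≗ z → g y ≡ g z

evalM-extensional : ∀ {n} (M : MFormula n) → Extensional (evalM M)
evalM-extensional (var i)  y≗z = y≗z i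
evalM-extensional (M ∧ᵐ N) y≗z = cong₂ _∧_ (evalM-extensional M y≗z) (evalM-extensional N y≗z)
evalM-extensional (M ∨ᵐ N) y≗z = cong₂ _∨_ (evalM-extensional M y≗z) (evalM-extensional N y≗z)

Thr-extensional : ∀ {n t} → Extensional (Thr n t)
Thr-extensional {t = t} y≗z = cong (λ c → ⌊ t ≤? c ⌋) (count-cong y≗z)

MComputes? : ∀ {n} {g : BoolFun n} → Extensional g → U.Decidable (λ M → MComputes M g)
MComputes? {g = g} g-ext M = all-assignments?
  (λ y≗z M≡g → trans (sym (evalM-extensional M y≗z)) (trans M≡g (g-ext y≗z)))
  (λ y → evalM M y ≟ᴮ g y)

Thr-sizeMono : ∀ {n t} → 0 < t → t ≤ n → Σ ℕ (IsSizeMono (Thr n t))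
Thr-sizeMono 0<t t≤n = minimalFormula (MComputes? Thr-extensional) (thresholdFormula 0<t t≤n)

hide : Bool → Bool → K3
hide s true  = ku
hide s false = embed (not s)

lower-hide-true : ∀ b → lower (hide true b) ≡ false
lower-hide-true true  = refl
lower-hide-true false = refl

upper-hide-true : ∀ b → upper (hide true b) ≡ b
upper-hide-true true  = refl
upper-hide-true false = refl

lower-hide-false : ∀ b → lower (hide false b) ≡ not b
lower-hide-false true  = refl
lower-hide-false false = refl

upper-hide-false : ∀ b → upper (hide false b) ≡ true
upper-hide-false true  = refl
upper-hide-false false = refl

polarise : Bool → K3 → K3
polarise true  v = v
polarise false v = notK v

polarise-notK : ∀ p v → polarise p (notK v) ≡ polarise (not p) v
polarise-notK true  v  = refl
polarise-notK false k0 = refl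
polarise-notK false ku = refl
polarise-notK false k1 = refl

-- keepLiterals s F p reads F (negated if p is false) in negation normal form, keeps the
-- literals of sign s as variables and replaces the literals of the other sign by 1.
keepLiterals : ∀ {n} → Bool → Formula n → Bool → MFormulaᶜ n
keepLiterals s (var i)  p     = if s xor p then const true else ⌜ var i ⌝
keepLiterals s (¬ᶠ F)   p     = keepLiterals s F (not p)
keepLiterals s (F ∧ᶠ G) true  = keepLiterals s F true  ∧ᶜ keepLiterals s G true
keepLiterals s (F ∧ᶠ G) false = keepLiterals s F false ∨ᶜ keepLiterals s G false
keepLiterals s (F ∨ᶠ G) true  = keepLiterals s F true  ∨ᶜ keepLiterals s G true
keepLiterals s (F ∨ᶠ G) false = keepLiterals s F false ∧ᶜ keepLiterals s G false

upper-keepLiterals : ∀ {n} s (F : Formula n) p y →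
  upper (polarise p (evalK F (hide s ∘ y))) ≡ evalᶜ (keepLiterals s F p) y
upper-keepLiterals true  (var i) true  y = upper-hide-true (y i)
upper-keepLiterals true  (var i) false y = trans (upper-notK _) (cong not (lower-hide-true (y i)))
upper-keepLiterals false (var i) true  y = upper-hide-false (y i)
upper-keepLiterals false (var i) false y =
  trans (upper-notK _) (trans (cong not (lower-hide-false (y i))) (not-involutive (y i)))
upper-keepLiterals s (¬ᶠ F) p y =
  trans (cong upper (polarise-notK p _)) (upper-keepLiterals s F (not p) y)
upper-keepLiterals s (F ∧ᶠ G) true y =
  trans (upper-andK _ _) (trans (cong₂ _∧_ (upper-keepLiterals s F true y) (upper-keepLiterals s G true y))
                                (sym (evalᶜ-∧ᶜ (keepLiterals s F true) (keepLiterals s G true) y)))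
upper-keepLiterals s (F ∧ᶠ G) false y =
  trans (cong upper (notK-andK _ _)) (trans (upper-orK _ _)
    (trans (cong₂ _∨_ (upper-keepLiterals s F false y) (upper-keepLiterals s G false y))
           (sym (evalᶜ-∨ᶜ (keepLiterals s F false) (keepLiterals s G false) y))))
upper-keepLiterals s (F ∨ᶠ G) true y =
  trans (upper-orK _ _) (trans (cong₂ _∨_ (upper-keepLiterals s F true y) (upper-keepLiterals s G true y))
                               (sym (evalᶜ-∨ᶜ (keepLiterals s F true) (keepLiterals s G true) y)))
upper-keepLiterals s (F ∨ᶠ G) false y =
  trans (cong upper (notK-orK _ _)) (trans (upper-andK _ _)
    (trans (cong₂ _∧_ (upper-keepLiterals s F false y) (upper-keepLiterals s G false y))
           (sym (evalᶜ-∧ᶜ (keepLiterals s F false) (keepLiterals s G false) y))))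

leavesᶜ-gates : ∀ {n m m′} (_⊙_ : MFormulaᶜ n → MFormulaᶜ n → MFormulaᶜ n) →
  (∀ A B → leavesᶜ (A ⊙ B) ≤ leavesᶜ A + leavesᶜ B) → (A B : Bool → MFormulaᶜ n) →
  leavesᶜ (A true) + leavesᶜ (A false) ≤ m → leavesᶜ (B true) + leavesᶜ (B false) ≤ m′ →
  leavesᶜ (A true ⊙ B true) + leavesᶜ (A false ⊙ B false) ≤ m + m′
leavesᶜ-gates {m = m} {m′} _⊙_ leavesᶜ-⊙ A B A≤m B≤m′ = begin
  leavesᶜ (A true ⊙ B true) + leavesᶜ (A false ⊙ B false)  ≤⟨ +-mono-≤ (leavesᶜ-⊙ _ _) (leavesᶜ-⊙ _ _) ⟩
  (a₁ + b₁) + (a₀ + b₀)                                     ≡⟨ interchange a₁ b₁ a₀ b₀ ⟩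
  (a₁ + a₀) + (b₁ + b₀)                                     ≤⟨ +-mono-≤ A≤m B≤m′ ⟩
  m + m′                                                    ∎
  where
  open ≤-Reasoning
  a₁ a₀ b₁ b₀ : ℕ
  a₁ = leavesᶜ (A true)
  a₀ = leavesᶜ (A false)
  b₁ = leavesᶜ (B true)
  b₀ = leavesᶜ (B false)

leaves-keepLiterals : ∀ {n} (F : Formula n) p →
  leavesᶜ (keepLiterals true F p) + leavesᶜ (keepLiterals false F p) ≤ leaves F
leaves-keepLiterals (var i)  true  = ≤-refl
leaves-keepLiterals (var i)  false = ≤-refl
leaves-keepLiterals (¬ᶠ F)   p     = leaves-keepLiterals F (not p)
leaves-keepLiterals (F ∧ᶠ G) true  = leavesᶜ-gates _∧ᶜ_ leavesᶜ-∧ᶜ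
  (λ s → keepLiterals s F true) (λ s → keepLiterals s G true)
  (leaves-keepLiterals F true) (leaves-keepLiterals G true)
leaves-keepLiterals (F ∧ᶠ G) false = leavesᶜ-gates _∨ᶜ_ leavesᶜ-∨ᶜ
  (λ s → keepLiterals s F false) (λ s → keepLiterals s G false)
  (leaves-keepLiterals F false) (leaves-keepLiterals G false)
leaves-keepLiterals (F ∨ᶠ G) true  = leavesᶜ-gates _∨ᶜ_ leavesᶜ-∨ᶜ
  (λ s → keepLiterals s F true) (λ s → keepLiterals s G true)
  (leaves-keepLiterals F true) (leaves-keepLiterals G true)
leaves-keepLiterals (F ∨ᶠ G) false = leavesᶜ-gates _∧ᶜ_ leavesᶜ-∧ᶜ
  (λ s → keepLiterals s F false) (λ s → keepLiterals s G false)
  (leaves-keepLiterals F false) (leaves-keepLiterals G false)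

module _ {n a b′} {F : Formula n} (a≤b′ : a ≤ b′) (hf : HazardFree F (Rng n a (suc b′))) where
  open ≡-Reasoning

  keepLiterals-true≗Thr : ∀ y → evalᶜ (keepLiterals true F true) y ≡ Thr n a y
  keepLiterals-true≗Thr y = begin
    evalᶜ (keepLiterals true F true) y                  ≡⟨ upper-keepLiterals true F true y ⟨
    upper (evalK F x)                                   ≡⟨ hazardFree-Rng⇒upper {F = F} (s≤s a≤b′) hf x ⟩
    ⌊ a ≤? upperCount x ⌋ ∧ ⌊ lowerCount x <? suc b′ ⌋  ≡⟨ cong₂ (λ K k → ⌊ a ≤? K ⌋ ∧ ⌊ k <? suc b′ ⌋)
                                                             (count-cong (upper-hide-true ∘ y))
                                                             (count-false (lower-hide-true ∘ y)) ⟩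
    ⌊ a ≤? count y ⌋ ∧ true                             ≡⟨ ∧-identityʳ _ ⟩
    Thr n a y                                           ∎
    where x = hide true ∘ y

  keepLiterals-false≗Thr : a ≤ n → ∀ y → evalᶜ (keepLiterals false F true) y ≡ Thr n (n ∸ b′) y
  keepLiterals-false≗Thr a≤n y = begin
    evalᶜ (keepLiterals false F true) y                 ≡⟨ upper-keepLiterals false F true y ⟨
    upper (evalK F x)                                   ≡⟨ hazardFree-Rng⇒upper {F = F} (s≤s a≤b′) hf x ⟩
    ⌊ a ≤? upperCount x ⌋ ∧ ⌊ lowerCount x <? suc b′ ⌋  ≡⟨ cong₂ _∧_
      (isYes-true (a ≤? upperCount x) (≤-trans a≤n (≤-reflexive (sym (count-true (upper-hide-false ∘ y))))))
      (sym (complement-threshold b′ (trans (+-comm (count y) _) (count-complement (lower-hide-false ∘ y))))) ⟩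
    true ∧ Thr n (n ∸ b′) y                             ∎
    where x = hide false ∘ y

hazardFree-Rng⇒sizes≤leaves : ∀ {n a b′ s₁ s₂} {F : Formula n} → 0 < a → a ≤ b′ → b′ < n →
  IsSizeMono (Thr n a) s₁ → IsSizeMono (Thr n (n ∸ b′)) s₂ → HazardFree F (Rng n a (suc b′)) →
  s₁ + s₂ ≤ leaves F
hazardFree-Rng⇒sizes≤leaves {n} {a} {b′} {F = F} 0<a a≤b′ b′<n size₁ size₂ hf = ≤-trans
  (+-mono-≤ (size≤leavesᶜ size₁ (keepLiterals true F true) (keepLiterals-true≗Thr {F = F} a≤b′ hf)
                          (Thr-nonconstant 0<a a≤n))
            (size≤leavesᶜ size₂ (keepLiterals false F true) (keepLiterals-false≗Thr {F = F} a≤b′ hf a≤n)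
                          (Thr-nonconstant (m<n⇒0<n∸m b′<n) (m∸n≤m n b′))))
  (leaves-keepLiterals F true)
  where
  a≤n : a ≤ n
  a≤n = ≤-trans a≤b′ (<⇒≤ b′<n)

substitute : ∀ {n m} → MFormula n → (Fin n → Formula m) → Formula m
substitute (var i)  ℓ = ℓ i
substitute (M ∧ᵐ N) ℓ = substitute M ℓ ∧ᶠ substitute N ℓ
substitute (M ∨ᵐ N) ℓ = substitute M ℓ ∨ᶠ substitute N ℓ

module _ {n m} {ℓ : Fin n → Formula m} where

  leaves-substitute : (∀ i → leaves (ℓ i) ≡ 1) → ∀ M → leaves (substitute M ℓ) ≡ mleaves M
  leaves-substitute ℓ≡1 (var i)  = ℓ≡1 i
  leaves-substitute ℓ≡1 (M ∧ᵐ N) = cong₂ _+_ (leaves-substitute ℓ≡1 M) (leaves-substitute ℓ≡1 N)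
  leaves-substitute ℓ≡1 (M ∨ᵐ N) = cong₂ _+_ (leaves-substitute ℓ≡1 M) (leaves-substitute ℓ≡1 N)

  lower-substitute : ∀ M x → lower (evalK (substitute M ℓ) x) ≡ evalM M (λ i → lower (evalK (ℓ i) x))
  lower-substitute (var i)  x = refl
  lower-substitute (M ∧ᵐ N) x = trans (lower-andK _ _) (cong₂ _∧_ (lower-substitute M x) (lower-substitute N x))
  lower-substitute (M ∨ᵐ N) x = trans (lower-orK _ _) (cong₂ _∨_ (lower-substitute M x) (lower-substitute N x))

  upper-substitute : ∀ M x → upper (evalK (substitute M ℓ) x) ≡ evalM M (λ i → upper (evalK (ℓ i) x))
  upper-substitute (var i)  x = refl
  upper-substitute (M ∧ᵐ N) x = trans (upper-andK _ _) (cong₂ _∧_ (upper-substitute M x) (upper-substitute N x))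
  upper-substitute (M ∨ᵐ N) x = trans (upper-orK _ _) (cong₂ _∨_ (upper-substitute M x) (upper-substitute N x))

rangeFormula : ∀ {n} → MFormula n → MFormula n → Formula n
rangeFormula M N = substitute M var ∧ᶠ substitute N (λ i → ¬ᶠ (var i))

leaves-rangeFormula : ∀ {n} (M N : MFormula n) → leaves (rangeFormula M N) ≡ mleaves M + mleaves N
leaves-rangeFormula M N = cong₂ _+_ (leaves-substitute (λ _ → refl) M) (leaves-substitute (λ _ → refl) N)

rangeFormula-hazardFree : ∀ {n a b′} (M N : MFormula n) → a ≤ b′ →
  MComputes M (Thr n a) → MComputes N (Thr n (n ∸ b′)) → HazardFree (rangeFormula M N) (Rng n a (suc b′))
rangeFormula-hazardFree {n} {a} {b′} M N a≤b′ M-Thr N-Thr =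
  bounds⇒hazardFree-Rng {F = rangeFormula M N} (s≤s a≤b′) lower-F upper-F
  where
  open ≡-Reasoning
  lower-F : ∀ x → lower (evalK (rangeFormula M N) x) ≡ lowerRng a (suc b′) x
  lower-F x = begin
    lower (evalK (rangeFormula M N) x)                              ≡⟨ lower-andK _ _ ⟩
    lower (evalK (substitute M _) x) ∧ lower (evalK (substitute N _) x)
                                                                    ≡⟨ cong₂ _∧_ (lower-substitute M x)
                                                                                 (lower-substitute N x) ⟩
    evalM M (lower ∘ x) ∧ evalM N (λ i → lower (notK (x i)))       ≡⟨ cong₂ _∧_ (M-Thr _) (N-Thr _) ⟩
    Thr n a (lower ∘ x) ∧ Thr n (n ∸ b′) (λ i → lower (notK (x i))) ≡⟨ cong (_ ∧_) (complement-threshold b′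
                                                                         (count-complement (lower-notK ∘ x))) ⟩
    lowerRng a (suc b′) x                                           ∎
  upper-F : ∀ x → upper (evalK (rangeFormula M N) x) ≡ upperRng a (suc b′) x
  upper-F x = begin
    upper (evalK (rangeFormula M N) x)                              ≡⟨ upper-andK _ _ ⟩
    upper (evalK (substitute M _) x) ∧ upper (evalK (substitute N _) x)
                                                                    ≡⟨ cong₂ _∧_ (upper-substitute M x)
                                                                                 (upper-substitute N x) ⟩
    evalM M (upper ∘ x) ∧ evalM N (λ i → upper (notK (x i)))       ≡⟨ cong₂ _∧_ (M-Thr _) (N-Thr _) ⟩
    Thr n a (upper ∘ x) ∧ Thr n (n ∸ b′) (λ i → upper (notK (x i))) ≡⟨ cong (_ ∧_) (complement-threshold b′
                                                                         (count-complement (upper-notK ∘ x))) ⟩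
    upperRng a (suc b′) x                                           ∎

Rng-sizeU : ∀ {n a b′ s₁ s₂} → 0 < a → a ≤ b′ → b′ < n →
  IsSizeMono (Thr n a) s₁ → IsSizeMono (Thr n (n ∸ b′)) s₂ → IsSizeU (Rng n a (suc b′)) (s₁ + s₂)
Rng-sizeU 0<a a≤b′ b′<n size₁@((M , M-Thr , M≡s₁) , _) size₂@((N , N-Thr , N≡s₂) , _) =
  (rangeFormula M N , rangeFormula-hazardFree M N a≤b′ M-Thr N-Thr ,
   trans (leaves-rangeFormula M N) (cong₂ _+_ M≡s₁ N≡s₂)) ,
  (λ F → hazardFree-Rng⇒sizes≤leaves {F = F} 0<a a≤b′ b′<n size₁ size₂)

proposition4p10 : (n a b : ℕ) → 0 < a → a < b → b ≤ n →
    Σ ℕ (λ s₁ → Σ ℕ (λ s₂ →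
      IsSizeMono (Thr n a) s₁ ×
      IsSizeMono (Thr n (n ∸ (b ∸ 1))) s₂ ×
      IsSizeU (Rng n a b) (s₁ + s₂)))
proposition4p10 n a zero     0<a ()
proposition4p10 n a (suc b′) 0<a (s≤s a≤b′) b′<n =
  let s₁ , size₁ = Thr-sizeMono 0<a (≤-trans a≤b′ (<⇒≤ b′<n))
      s₂ , size₂ = Thr-sizeMono (m<n⇒0<n∸m b′<n) (m∸n≤m n b′)
  in s₁ , s₂ , size₁ , size₂ , Rng-sizeU 0<a a≤b′ b′<n size₁ size₂
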